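{- Let $k\geq 3$ be an integer and let $S$ be a set of integers containing no arithmetic progression of length $k$. Let $a_0$ be an integer, let $A=\{a_1, \ldots, a_d\}$ be a set of non-zero integers ($d\ge 1$), and suppose $H(a_0; a_1, \ldots, a_d) \subset S$. Then \[ |H(a_0; a_1, \ldots, a_d)|\geq 2 \left( \frac{k}{k-1} \right)^{d-1}-1. \]
   Context: An arithmetic progression of length $k$ is a set $\{b, b+h, \dots, b+(k-1)h\}$ with integers $b,h$, $h\neq 0$. For integers $a_0\neq 0, a_1,\dots,a_d$, the Hilbert cube is $H(a_0;a_1,\dots,a_d)=\{a_0+\sum_{i=1}^d \varepsilon_i a_i : \varepsilon_i\in\{0,1\}\}$; for $a_0=0$ the empty sum is excluded: $H(0;a_1,\dots,a_d)=\{\sum_{i=1}^d \varepsilon_i a_i : \varepsilon_i\in\{0,1\},\ \sum_i \varepsilon_i>0\}$. $|\cdot|$ denotes cardinality. -}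

module Defs where

open import Data.Nat using (ℕ; zero; suc; _<_)
open import Data.Integer using (ℤ; +_; -[1+_]; _+_; _*_; 0ℤ)
import Data.Integer.Properties as ℤP
open import Data.Fin using (Fin)
open import Data.List using (List; []; _∷_; _++_; map; length; deduplicate; tabulate)
open import Data.Product using (∃; ∃-syntax; _×_)
open import Relation.Binary.PropositionalEquality using (_≢_)
open import Relation.Nullary using (¬_)

ContainsAP : ℕ → (ℤ → Set) → Set
ContainsAP k S = ∃[ b ] ∃[ h ] (h ≢ 0ℤ × (∀ (i : ℕ) → i < k → S (b + (+ i) * h)))

subsetSums : List ℤ → List ℤ
subsetSums [] = 0ℤ ∷ []
subsetSums (x ∷ xs) = subsetSums xs ++ map (λ s → x + s) (subsetSums xs)

nonemptySums : List ℤ → List ℤ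
nonemptySums [] = []
nonemptySums (x ∷ xs) = nonemptySums xs ++ map (λ s → x + s) (subsetSums xs)

-- Elements (with repetitions) of the Hilbert cube H(a0; a_1,...,a_d),
-- with the paper's convention that for a0 = 0 the empty sum is excluded.
cubeList : ℤ → List ℤ → List ℤ
cubeList (+ zero) as = nonemptySums as
cubeList a0@(+ suc _) as = map (λ s → a0 + s) (subsetSums as)
cubeList a0@(-[1+ _ ]) as = map (λ s → a0 + s) (subsetSums as)

-- H(a0; a(0), ..., a(d-1)) as a list (membership = membership in the set)
hilbertCube : ℤ → {d : ℕ} → (Fin d → ℤ) → List ℤ
hilbertCube a0 a = cubeList a0 (tabulate a)

cubeCard : ℤ → {d : ℕ} → (Fin d → ℤ) → ℕ
cubeCard a0 a = length (deduplicate ℤP._≟_ (hilbertCube a0 a))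

module Submission where

-- Write k = 2 + K.  Adjoining a new
-- generator x ≠ 0 to a Hilbert cube C' gives the cube C = C' ∪ (x + C').
-- Let T = C ∖ C'.  Walking from z ∈ C' along z, z + x, z + 2x, ... we stay
-- in C' until we first hit T; since C ⊆ S has no k-term progression, this
-- happens after at most K steps.  Hence every z ∈ C' is t - j·x for some
-- t ∈ T and 1 ≤ j ≤ K, so |C'| ≤ K·|T|; also |C'| + |T| ≤ |C| and T ≠ ∅.
-- Together: (K+2)(|C'|+1) ≤ (K+1)(|C|+1), i.e. |C|+1 ≥ k/(k-1) (|C'|+1).
-- Iterating over the d generators, starting from |H| ≥ 1 for d = 1,
-- gives 2 k^(d-1) ≤ (|H|+1)(k-1)^(d-1).

open import Defs
open import Data.Nat using (ℕ; _≤_; _*_; _+_; _∸_; _^_)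
open import Data.Integer using (ℤ; 0ℤ)
open import Data.Fin using (Fin)
import Data.Fin as Fin
open import Data.List.Membership.Propositional using (_∈_)
open import Function.Definitions using (Injective)
open import Relation.Binary.PropositionalEquality using (_≡_; _≢_)
open import Relation.Nullary using (¬_)

import Data.Nat as ℕ
import Data.Nat.Properties as ℕP
import Data.Integer as ℤ
import Data.Integer.Properties as ℤP
open import Data.Nat.Tactic.RingSolver using () renaming (solve-∀ to ℕ-solve-∀)
open import Data.Integer.Tactic.RingSolver using () renaming (solve-∀ to ℤ-solve-∀)
open import Data.List
  using (List; []; _∷_; _++_; map; length; deduplicate; filter; tabulate;
         cartesianProductWith; applyUpTo)
import Data.List.Properties as LP
open import Data.List.Membership.Propositional using (_∉_)
open import Data.List.Membership.Propositional.Properties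
open import Data.List.Membership.DecPropositional ℤP._≟_ using (_∈?_)
open import Data.List.Relation.Binary.Subset.Propositional using (_⊆_)
open import Data.List.Relation.Unary.Any using (here; there)
open import Data.List.Relation.Unary.All using (All; _∷_) renaming (lookup to All-lookup)
open import Data.List.Relation.Unary.All.Properties using (tabulate⁺)
open import Data.List.Relation.Unary.Unique.Propositional using (Unique; _∷_)
open import Data.List.Relation.Unary.Unique.DecPropositional.Properties ℤP._≟_
  using (deduplicate-!)
open import Data.Product using (∃-syntax; _×_; _,_; proj₂)
open import Data.Sum using (_⊎_; inj₁; inj₂)
open import Data.Empty using (⊥-elim)
open import Relation.Nullary using (Dec; yes; no)
open import Relation.Unary.Properties using (∁?)
open import Relation.Binary.PropositionalEquality using (refl; sym; trans; cong; cong₂; subst; module ≡-Reasoning)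

-- The number of distinct elements of a list; cubeCard a0 a is
-- definitionally ∣ hilbertCube a0 a ∣.
∣_∣ : List ℤ → ℕ
∣ xs ∣ = length (deduplicate ℤP._≟_ xs)

unique-⊆-length : ∀ {A : Set} {xs ys : List A} → Unique xs → xs ⊆ ys →
                  length xs ≤ length ys
unique-⊆-length {xs = []} _ _ = ℕ.z≤n
unique-⊆-length {xs = x ∷ xs} {ys} (x∉xs ∷ uxs) xs⊆ys
  with us , vs , refl ← ∈-∃++ (xs⊆ys (here refl)) = begin
    ℕ.suc (length xs)          ≤⟨ ℕ.s≤s (unique-⊆-length uxs xs⊆us++vs) ⟩
    ℕ.suc (length (us ++ vs))  ≡⟨ cong ℕ.suc (LP.length-++ us) ⟩
    ℕ.suc (length us + length vs) ≡⟨ sym (ℕP.+-suc (length us) (length vs)) ⟩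
    length us + length (x ∷ vs) ≡⟨ sym (LP.length-++ us) ⟩
    length (us ++ x ∷ vs)      ∎
  where
  open ℕP.≤-Reasoning
  xs⊆us++vs : xs ⊆ us ++ vs
  xs⊆us++vs z∈xs with ∈-++⁻ us (xs⊆ys (there z∈xs))
  ... | inj₁ z∈us         = ∈-++⁺ˡ z∈us
  ... | inj₂ (here z≡x)   = ⊥-elim (All-lookup x∉xs z∈xs (sym z≡x))
  ... | inj₂ (there z∈vs) = ∈-++⁺ʳ us z∈vs

card-≤-length : ∀ {xs ys : List ℤ} → xs ⊆ ys → ∣ xs ∣ ≤ length ys
card-≤-length {xs} xs⊆ys =
  unique-⊆-length (deduplicate-! xs) (λ z∈ → xs⊆ys (∈-deduplicate⁻ ℤP._≟_ xs z∈))

card-pos : ∀ {z : ℤ} {xs : List ℤ} → z ∈ xs → 1 ≤ ∣ xs ∣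
card-pos z∈xs = ∈-length (∈-deduplicate⁺ ℤP._≟_ z∈xs)

length-filter-split : ∀ {A : Set} {P : A → Set} (P? : ∀ z → Dec (P z)) (xs : List A) →
  length (filter P? xs) + length (filter (∁? P?) xs) ≡ length xs
length-filter-split P? [] = refl
length-filter-split P? (x ∷ xs) with P? x
... | yes _ = cong ℕ.suc (length-filter-split P? xs)
... | no _  = trans (ℕP.+-suc _ _) (cong ℕ.suc (length-filter-split P? xs))

length-cartesianProductWith : ∀ {A B C : Set} (f : A → B → C) (xs : List A) (ys : List B) →
  length (cartesianProductWith f xs ys) ≡ length xs * length ys
length-cartesianProductWith f [] ys = refl
length-cartesianProductWith f (x ∷ xs) ys = begin
  length (map (f x) ys ++ cartesianProductWith f xs ys)
    ≡⟨ LP.length-++ (map (f x) ys) ⟩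
  length (map (f x) ys) + length (cartesianProductWith f xs ys)
    ≡⟨ cong₂ _+_ (LP.length-map (f x) ys) (length-cartesianProductWith f xs ys) ⟩
  length ys + length xs * length ys ∎
  where open ≡-Reasoning

record Extends (x : ℤ) (C' C : List ℤ) : Set where
  field
    keep  : C' ⊆ C
    shift : ∀ {y} → y ∈ C' → x ℤ.+ y ∈ C

0∈subsetSums : ∀ L → 0ℤ ∈ subsetSums L
0∈subsetSums []      = here refl
0∈subsetSums (x ∷ L) = ∈-++⁺ˡ (0∈subsetSums L)

nonemptySums⊆subsetSums : ∀ L → nonemptySums L ⊆ subsetSums L
nonemptySums⊆subsetSums (x ∷ L) y∈ with ∈-++⁻ (nonemptySums L) y∈
... | inj₁ y∈ne = ∈-++⁺ˡ (nonemptySums⊆subsetSums L y∈ne)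
... | inj₂ y∈x+ = ∈-++⁺ʳ (subsetSums L) y∈x+

subsetSums-extends : ∀ x L → Extends x (subsetSums L) (subsetSums (x ∷ L))
subsetSums-extends x L = record
  { keep  = ∈-++⁺ˡ
  ; shift = λ y∈ → ∈-++⁺ʳ (subsetSums L) (∈-map⁺ (ℤ._+_ x) y∈)
  }

nonemptySums-extends : ∀ x L → Extends x (nonemptySums L) (nonemptySums (x ∷ L))
nonemptySums-extends x L = record
  { keep  = ∈-++⁺ˡ
  ; shift = λ y∈ → ∈-++⁺ʳ (nonemptySums L)
                     (∈-map⁺ (ℤ._+_ x) (nonemptySums⊆subsetSums L y∈))
  }

translate-extends : ∀ a0 {x C' C} → Extends x C' C →
                    Extends x (map (ℤ._+_ a0) C') (map (ℤ._+_ a0) C)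
translate-extends a0 {x} {C' = C'} {C} ext = record
  { keep  = λ y∈ → let (s , s∈ , y≡) = ∈-map⁻ (ℤ._+_ a0) y∈ in
                   subst (_∈ map (ℤ._+_ a0) C) (sym y≡) (∈-map⁺ (ℤ._+_ a0) (keep s∈))
  ; shift = λ y∈ → let (s , s∈ , y≡) = ∈-map⁻ (ℤ._+_ a0) y∈ in
                   subst (_∈ map (ℤ._+_ a0) C) (swap s y≡) (∈-map⁺ (ℤ._+_ a0) (shift s∈))
  }
  where
  open Extends ext
  swap : ∀ s {y} → y ≡ a0 ℤ.+ s → a0 ℤ.+ (x ℤ.+ s) ≡ x ℤ.+ y
  swap s refl = exchange a0 x s
    where
    exchange : ∀ a b c → a ℤ.+ (b ℤ.+ c) ≡ b ℤ.+ (a ℤ.+ c)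
    exchange = ℤ-solve-∀

cube-extends : ∀ a0 x L → Extends x (cubeList a0 L) (cubeList a0 (x ∷ L))
cube-extends (ℤ.+ ℕ.zero)      x L = nonemptySums-extends x L
cube-extends a0@(ℤ.+ ℕ.suc _)  x L = translate-extends a0 (subsetSums-extends x L)
cube-extends a0@(ℤ.-[1+ _ ])   x L = translate-extends a0 (subsetSums-extends x L)

cube-nonempty : ∀ a0 x L → ∃[ z ] z ∈ cubeList a0 (x ∷ L)
cube-nonempty (ℤ.+ ℕ.zero)     x L = x ℤ.+ 0ℤ , ∈-++⁺ʳ (nonemptySums L) (∈-map⁺ (ℤ._+_ x) (0∈subsetSums L))
cube-nonempty a0@(ℤ.+ ℕ.suc _) x L = a0 ℤ.+ 0ℤ , ∈-map⁺ (ℤ._+_ a0) (0∈subsetSums (x ∷ L))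
cube-nonempty a0@(ℤ.-[1+ _ ])  x L = a0 ℤ.+ 0ℤ , ∈-map⁺ (ℤ._+_ a0) (0∈subsetSums (x ∷ L))

growth-arith : ∀ K n t m → n ≤ t * K → 1 ≤ t → n + t ≤ m →
               (2 + K) * (n + 1) ≤ (1 + K) * (m + 1)
growth-arith K n t m n≤tK 1≤t n+t≤m = begin
  (2 + K) * (n + 1)             ≡⟨ split K n ⟩
  (1 + K) * (n + 1) + (n + 1)   ≤⟨ ℕP.+-monoʳ-≤ ((1 + K) * (n + 1)) (ℕP.+-mono-≤ n≤tK 1≤t) ⟩
  (1 + K) * (n + 1) + (t * K + t) ≡⟨ merge K n t ⟩
  (1 + K) * ((n + t) + 1)       ≤⟨ ℕP.*-monoʳ-≤ (1 + K) (ℕP.+-monoˡ-≤ 1 n+t≤m) ⟩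
  (1 + K) * (m + 1)             ∎
  where
  open ℕP.≤-Reasoning
  split : ∀ K n → (2 + K) * (n + 1) ≡ (1 + K) * (n + 1) + (n + 1)
  split = ℕ-solve-∀
  merge : ∀ K n t → (1 + K) * (n + 1) + (t * K + t) ≡ (1 + K) * ((n + t) + 1)
  merge = ℕ-solve-∀

module OneStep {K : ℕ} {S : ℤ → Set} (noAP : ¬ ContainsAP (2 + K) S)
               {x : ℤ} (x≢0 : x ≢ 0ℤ) {C' C : List ℤ} (ext : Extends x C' C)
               (C⊆S : ∀ y → y ∈ C → S y) where
  open Extends ext

  pt : ℤ → ℕ → ℤ
  pt z i = z ℤ.+ ℤ.+ i ℤ.* x

  pt-suc : ∀ z i → pt z (ℕ.suc i) ≡ x ℤ.+ pt z i
  pt-suc z i = identity z x (ℤ.+ i)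
    where
    identity : ∀ z x n → z ℤ.+ (ℤ.+ 1 ℤ.+ n) ℤ.* x ≡ x ℤ.+ (z ℤ.+ n ℤ.* x)
    identity = ℤ-solve-∀

  Exit : ℤ → ℕ → Set
  Exit z n = ∃[ j ] (1 ≤ j × j ≤ n × pt z j ∈ C × pt z j ∉ C')

  next∈C : ∀ z n → (∀ i → i ≤ n → pt z i ∈ C') → pt z (ℕ.suc n) ∈ C
  next∈C z n stay = subst (_∈ C) (sym (pt-suc z n)) (shift (stay n ℕP.≤-refl))

  walk : ∀ {z} → z ∈ C' → ∀ n → (∀ i → i ≤ n → pt z i ∈ C') ⊎ Exit z n
  walk {z} z∈C' ℕ.zero = inj₁ start
    where
    start : ∀ i → i ≤ 0 → pt z i ∈ C'
    start ℕ.zero _ = subst (_∈ C') (sym (ℤP.+-identityʳ z)) z∈C'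
  walk {z} z∈C' (ℕ.suc n) with walk z∈C' n
  ... | inj₂ (j , 1≤j , j≤n , j∈C , j∉C') = inj₂ (j , 1≤j , ℕP.m≤n⇒m≤1+n j≤n , j∈C , j∉C')
  ... | inj₁ stay with pt z (ℕ.suc n) ∈? C'
  ...   | no  n+1∉C' = inj₂ (ℕ.suc n , ℕ.s≤s ℕ.z≤n , ℕP.≤-refl , next∈C z n stay , n+1∉C')
  ...   | yes n+1∈C' = inj₁ stay′
    where
    stay′ : ∀ i → i ≤ ℕ.suc n → pt z i ∈ C'
    stay′ i i≤n+1 with ℕP.m≤n⇒m<n∨m≡n i≤n+1
    ... | inj₁ (ℕ.s≤s i≤n) = stay i i≤n
    ... | inj₂ refl        = n+1∈C'

  -- The walk exits within K steps: otherwise z, z + x, ..., z + (K+1)x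
  -- would be a (2+K)-term progression in S.
  escape : ∀ {z} → z ∈ C' → Exit z K
  escape {z} z∈C' with walk z∈C' K
  ... | inj₂ exit = exit
  ... | inj₁ stay = ⊥-elim (noAP (z , x , x≢0 , progression))
    where
    progression : ∀ i → i ℕ.< 2 + K → S (pt z i)
    progression i (ℕ.s≤s i≤1+K) with ℕP.m≤n⇒m<n∨m≡n i≤1+K
    ... | inj₁ (ℕ.s≤s i≤K) = C⊆S _ (keep (stay i i≤K))
    ... | inj₂ refl        = C⊆S _ (next∈C z K stay)

  exits stays : List ℤ
  exits = filter (∁? (_∈? C')) (deduplicate ℤP._≟_ C)
  stays = filter (_∈? C') (deduplicate ℤP._≟_ C)

  exit∈exits : ∀ {y} → y ∈ C → y ∉ C' → y ∈ exits
  exit∈exits y∈C y∉C' = ∈-filter⁺ (∁? (_∈? C')) (∈-deduplicate⁺ ℤP._≟_ y∈C) y∉C'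

  shadow : List ℤ
  shadow = cartesianProductWith (λ t j → t ℤ.- ℤ.+ j ℤ.* x) exits (applyUpTo ℕ.suc K)

  C'⊆shadow : C' ⊆ shadow
  C'⊆shadow {z} z∈C' with escape z∈C'
  ... | ℕ.suc j , _ , j<K , j∈C , j∉C' =
    subst (_∈ shadow) (sym (cancel z (ℤ.+ ℕ.suc j ℤ.* x)))
      (∈-cartesianProductWith⁺ (λ t j → t ℤ.- ℤ.+ j ℤ.* x)
        (exit∈exits j∈C j∉C') (∈-applyUpTo⁺ ℕ.suc j<K))
    where
    cancel : ∀ z p → z ≡ (z ℤ.+ p) ℤ.- p
    cancel = ℤ-solve-∀

  card-C'≤ : ∣ C' ∣ ≤ length exits * K
  card-C'≤ = begin
    ∣ C' ∣         ≤⟨ card-≤-length C'⊆shadow ⟩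
    length shadow  ≡⟨ length-cartesianProductWith _ exits (applyUpTo ℕ.suc K) ⟩
    length exits * length (applyUpTo ℕ.suc K) ≡⟨ cong (length exits *_) (LP.length-applyUpTo ℕ.suc K) ⟩
    length exits * K ∎
    where open ℕP.≤-Reasoning

  card-C'+exits≤ : ∣ C' ∣ + length exits ≤ ∣ C ∣
  card-C'+exits≤ = begin
    ∣ C' ∣ + length exits         ≤⟨ ℕP.+-monoˡ-≤ (length exits) (card-≤-length C'⊆stays) ⟩
    length stays + length exits   ≡⟨ length-filter-split (_∈? C') (deduplicate ℤP._≟_ C) ⟩
    ∣ C ∣                          ∎
    where
    open ℕP.≤-Reasoning
    C'⊆stays : C' ⊆ stays
    C'⊆stays y∈C' = ∈-filter⁺ (_∈? C') (∈-deduplicate⁺ ℤP._≟_ (keep y∈C')) y∈C'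

  -- T is nonempty as soon as C is: any point of C is an exit or walks to one.
  exits-nonempty : ∀ {z} → z ∈ C → 1 ≤ length exits
  exits-nonempty {z} z∈C with z ∈? C'
  ... | no  z∉C' = ∈-length (exit∈exits z∈C z∉C')
  ... | yes z∈C' with escape z∈C'
  ...   | _ , _ , _ , j∈C , j∉C' = ∈-length (exit∈exits j∈C j∉C')

  one-step-bound : ∀ {z} → z ∈ C → (2 + K) * (∣ C' ∣ + 1) ≤ (1 + K) * (∣ C ∣ + 1)
  one-step-bound z∈C =
    growth-arith K _ _ _ card-C'≤ (exits-nonempty z∈C) card-C'+exits≤

iterate-arith : ∀ K Q P n m → 2 * Q ≤ (n + 1) * P →
                (2 + K) * (n + 1) ≤ (1 + K) * (m + 1) →
                2 * ((2 + K) * Q) ≤ (m + 1) * ((1 + K) * P)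
iterate-arith K Q P n m bound step = begin
  2 * ((2 + K) * Q)         ≡⟨ reassoc₁ K Q ⟩
  (2 + K) * (2 * Q)         ≤⟨ ℕP.*-monoʳ-≤ (2 + K) bound ⟩
  (2 + K) * ((n + 1) * P)   ≡⟨ sym (ℕP.*-assoc (2 + K) (n + 1) P) ⟩
  ((2 + K) * (n + 1)) * P   ≤⟨ ℕP.*-monoˡ-≤ P step ⟩
  ((1 + K) * (m + 1)) * P   ≡⟨ reassoc₂ K m P ⟩
  (m + 1) * ((1 + K) * P)   ∎
  where
  open ℕP.≤-Reasoning
  reassoc₁ : ∀ K Q → 2 * ((2 + K) * Q) ≡ (2 + K) * (2 * Q)
  reassoc₁ = ℕ-solve-∀
  reassoc₂ : ∀ K m P → ((1 + K) * (m + 1)) * P ≡ (m + 1) * ((1 + K) * P)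
  reassoc₂ = ℕ-solve-∀

cube-bound : ∀ {K S} → ¬ ContainsAP (2 + K) S → ∀ a0 x L →
             All (_≢ 0ℤ) (x ∷ L) → (∀ y → y ∈ cubeList a0 (x ∷ L) → S y) →
             2 * (2 + K) ^ length L ≤ (∣ cubeList a0 (x ∷ L) ∣ + 1) * (1 + K) ^ length L
cube-bound noAP a0 x [] _ _ =
  subst (2 ≤_) (sym (ℕP.*-identityʳ _))
    (ℕP.+-monoˡ-≤ 1 (card-pos (proj₂ (cube-nonempty a0 x []))))
cube-bound {K} noAP a0 x (y ∷ L) (x≢0 ∷ nonzero) C⊆S =
  iterate-arith K ((2 + K) ^ length L) ((1 + K) ^ length L) ∣ C' ∣ ∣ C ∣
    (cube-bound noAP a0 y L nonzero (λ z z∈ → C⊆S z (Extends.keep extension z∈)))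
    (OneStep.one-step-bound noAP x≢0 extension C⊆S (proj₂ (cube-nonempty a0 x (y ∷ L))))
  where
  C' C : List ℤ
  C' = cubeList a0 (y ∷ L)
  C  = cubeList a0 (x ∷ y ∷ L)
  extension : Extends x C' C
  extension = cube-extends a0 x (y ∷ L)

-- The theorem: write k = 2 + K and d = 1 + d', so the generators are
-- a 0 followed by the d' generators a (suc i).
lemma1 : (k : ℕ) → 3 ≤ k → (S : ℤ → Set) → ¬ ContainsAP k S →
         (a0 : ℤ) → (d : ℕ) → 1 ≤ d → (a : Fin d → ℤ) →
         Injective _≡_ _≡_ a → (∀ i → a i ≢ 0ℤ) →
         (∀ x → x ∈ hilbertCube a0 a → S x) →
         2 * k ^ (d ∸ 1) ≤ (cubeCard a0 a + 1) * (k ∸ 1) ^ (d ∸ 1)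
lemma1 (ℕ.suc ℕ.zero) (ℕ.s≤s ()) _ _ _ _ _ _ _ _ _
lemma1 (ℕ.suc (ℕ.suc K)) _ S noAP a0 (ℕ.suc d') _ a _ nonzero H⊆S =
  subst (λ e → 2 * (2 + K) ^ e ≤ (cubeCard a0 a + 1) * (1 + K) ^ e)
    (LP.length-tabulate (λ i → a (Fin.suc i)))
    (cube-bound noAP a0 (a Fin.zero) (tabulate (λ i → a (Fin.suc i)))
      (tabulate⁺ nonzero) H⊆S)
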